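{- Let $k$ be a positive integer and $\mathbb{F}$ a field of characteristic different from $2$ in which $-1$, $2$ and $2k-1$ all have square roots. Then $S^2_{2k}(X_1,\dots,X_{2k})$ can be computed by a homogeneous $\Sigma\Pi\Sigma$ circuit over $\mathbb{F}$ using $k$ multiplication gates.
   Context: $S_n^2(X_1,\dots,X_n) = \sum_{1\le i<j\le n} X_iX_j$. A $\Sigma\Pi\Sigma$ circuit over a field $\mathbb{F}$ in variables $X_1,\dots,X_n$ is an expression $\sum_{i=1}^r \prod_{j=1}^{s_i} L_{ij}(X)$ where each $L_{ij}$ is a linear form $a_0+\sum_{k=1}^n a_kX_k$ with $a_0,\dots,a_n\in\mathbb{F}$; $r$ is its number of multiplication gates. It is homogeneous if every $L_{ij}$ has constant term $0$. It computes a polynomial $P$ if the expression equals $P$ in $\mathbb{F}[X_1,\dots,X_n]$. -}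

module Defs where

open import Level using (Level; _⊔_) renaming (suc to lsuc)
open import Algebra.Bundles using (CommutativeRing)
open import Data.Nat as ℕ using (ℕ; zero; suc; _<?_)
open import Data.Fin using (Fin; toℕ)
open import Data.List using (List; []; _∷_; length; foldr; map; filter; cartesianProduct; allFin)
open import Data.Product using (_×_; _,_; proj₁; proj₂; ∃)
open import Relation.Nullary using (¬_)

record Field (c ℓ : Level) : Set (lsuc (c ⊔ ℓ)) where
  field
    commutativeRing : CommutativeRing c ℓ
  open CommutativeRing commutativeRing public
  field
    1≉0     : ¬ (1# ≈ 0#)
    inverse : ∀ x → ¬ (x ≈ 0#) → ∃ λ y → (x * y) ≈ 1#

module FieldDefs {c ℓ : Level} (F : Field c ℓ) where
  open Field F

  fromℕ : ℕ → Carrier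
  fromℕ zero    = 0#
  fromℕ (suc n) = 1# + fromℕ n

  minusOne : Carrier
  minusOne = - 1#

  two : Carrier
  two = 1# + 1#

  CharNot2 : Set ℓ
  CharNot2 = ¬ ((1# + 1#) ≈ 0#)

  HasSqrt : Carrier → Set (c ⊔ ℓ)
  HasSqrt a = ∃ λ r → (r * r) ≈ a

  -- The polynomial ring F[X_0,…,X_{n-1}], presented as polynomial
  -- expressions modulo the congruence generated by the commutative
  -- ring axioms and the requirement that constants form a copy of F
  -- (i.e. the free commutative F-algebra on n generators).
  infixl 6 _⊕_
  infixl 7 _⊗_
  infix  4 _≃_

  data Poly (n : ℕ) : Set c where
    con : Carrier → Poly n
    var : Fin n → Poly n
    _⊕_ : Poly n → Poly n → Poly n
    _⊗_ : Poly n → Poly n → Poly n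
    ⊖_  : Poly n → Poly n

  data _≃_ {n : ℕ} : Poly n → Poly n → Set (c ⊔ ℓ) where
    ≃-refl  : ∀ {p} → p ≃ p
    ≃-sym   : ∀ {p q} → p ≃ q → q ≃ p
    ≃-trans : ∀ {p q r} → p ≃ q → q ≃ r → p ≃ r
    ⊕-cong  : ∀ {p p′ q q′} → p ≃ p′ → q ≃ q′ → p ⊕ q ≃ p′ ⊕ q′
    ⊗-cong  : ∀ {p p′ q q′} → p ≃ p′ → q ≃ q′ → p ⊗ q ≃ p′ ⊗ q′
    ⊖-cong  : ∀ {p q} → p ≃ q → ⊖ p ≃ ⊖ q
    ⊕-assoc : ∀ p q r → (p ⊕ q) ⊕ r ≃ p ⊕ (q ⊕ r)
    ⊕-comm  : ∀ p q → p ⊕ q ≃ q ⊕ p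
    ⊕-idˡ   : ∀ p → con 0# ⊕ p ≃ p
    ⊖-invˡ  : ∀ p → (⊖ p) ⊕ p ≃ con 0#
    ⊗-assoc : ∀ p q r → (p ⊗ q) ⊗ r ≃ p ⊗ (q ⊗ r)
    ⊗-comm  : ∀ p q → p ⊗ q ≃ q ⊗ p
    ⊗-idˡ   : ∀ p → con 1# ⊗ p ≃ p
    ⊗-distribˡ : ∀ p q r → p ⊗ (q ⊕ r) ≃ (p ⊗ q) ⊕ (p ⊗ r)
    con-cong : ∀ {a b} → a ≈ b → con a ≃ con b
    con-+    : ∀ a b → con (a + b) ≃ con a ⊕ con b
    con-*    : ∀ a b → con (a * b) ≃ con a ⊗ con b

  sumP : ∀ {n} → List (Poly n) → Poly n
  sumP = foldr _⊕_ (con 0#)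

  prodP : ∀ {n} → List (Poly n) → Poly n
  prodP = foldr _⊗_ (con 1#)

  S2 : (n : ℕ) → Poly n
  S2 n = sumP (map (λ ij → var (proj₁ ij) ⊗ var (proj₂ ij))
                   (filter (λ ij → toℕ (proj₁ ij) <? toℕ (proj₂ ij))
                           (cartesianProduct (allFin n) (allFin n))))

  LinearForm : ℕ → Set c
  LinearForm n = Carrier × (Fin n → Carrier)

  ⟦_⟧L : ∀ {n} → LinearForm n → Poly n
  ⟦_⟧L {n} (a₀ , a) = con a₀ ⊕ sumP (map (λ k → con (a k) ⊗ var k) (allFin n))

  Circuit : ℕ → Set c
  Circuit n = List (List (LinearForm n))

  ⟦_⟧C : ∀ {n} → Circuit n → Poly n
  ⟦ C ⟧C = sumP (map (λ g → prodP (map ⟦_⟧L g)) C)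

  gates : ∀ {n} → Circuit n → ℕ
  gates = length

  Homogeneous : ∀ {n} → Circuit n → Set (c ⊔ ℓ)
  Homogeneous C = All (All (λ L → proj₁ L ≈ 0#)) C
    where open import Data.List.Relation.Unary.All using (All)

-- Split the 2k variables into pairs (u_a, v_a) and pass to y_a = u_a + ι v_a,
-- z_a = u_a - ι v_a, where ι² = -1.  Then Σ x_j² = Σ y_a z_a, and with
-- Y = Σ y_a, Z = Σ z_a one has 2 (Σ x_j)² = ι (Z² - Y²) + 2 Y Z, so that
-- 4 S² = ι (Z² - Y²) + 2 Y Z - 2 Σ y_a z_a.  Removing the k - 1 products
-- (y_b - y_0) (2 Z - 2 z_b - ι (Y + k y_0)), b ≥ 1, leaves a binary quadratic
-- form in y_0 and Z of discriminant -(2k - 1).  With t² = 2k - 1 it factors as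
-- ι (Z - (ι (k - 1) + t) y_0) (Z - (ι (k - 1) - t) y_0), the k-th product.
module Submission where

open import Level using (Level; _⊔_)
open import Algebra.Bundles using (CommutativeRing)
open import Data.Nat as ℕ using (ℕ; zero; suc)
import Data.Nat.Properties as ℕₚ
import Data.Integer as ℤ
import Data.Integer.Properties as ℤₚ
open import Data.Sign as Sign using ()
open import Data.Fin as Fin using (Fin; zero; suc; toℕ; _↑ˡ_; _↑ʳ_)
import Data.Fin.Properties as Finₚ
open import Data.List using (List; []; _∷_; foldr; map; filter; tabulate; cartesianProduct; _++_; allFin)
import Data.List.Properties as Listₚ
open import Data.List.Relation.Unary.All using ([]; _∷_)
open import Data.List.Relation.Unary.All.Properties using (tabulate⁺)
open import Data.Product using (∃; _×_; _,_; proj₁; proj₂)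
open import Data.Bool using (if_then_else_; true; false)
import Data.Maybe as Maybe
open import Function using (_∘_)
open import Relation.Nullary using (does)
open import Relation.Nullary.Decidable using (dec-true; dec-false)
open import Relation.Unary using (Decidable)
open import Relation.Binary.Definitions using (tri<; tri≈; tri>)
open import Relation.Binary.Consequences using (dec⇒weaklyDec)
open import Relation.Binary.PropositionalEquality as ≡ using (_≡_)
open import Relation.Binary.Bundles using (Setoid)
open import Defs

-- Algebra.Solver.Ring needs coefficients with decidable equality;
-- ℤ maps into every commutative ring.
module IntegerCoefficients {c ℓ : Level} (R : CommutativeRing c ℓ) where
  open ℤ using (ℤ; +_; -[1+_])
  open CommutativeRing R
  open import Algebra.Properties.Ring ring using (-‿distribˡ-*; -‿distribʳ-*; -‿involutive; -0#≈0#; -‿+-comm)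
  open import Algebra.Properties.AbelianGroup +-abelianGroup using (xyx⁻¹≈y)
  open import Algebra.Properties.Semiring.Mult.TCOptimised semiring using (1+×; ×-homo-+; ×1-homo-*) renaming (_×_ to _×′_)
  open import Relation.Binary.Reasoning.Setoid setoid
  open import Algebra.Solver.Ring.AlmostCommutativeRing
    using (fromCommutativeRing; _-Raw-AlmostCommutative⟶_)

  ⟦_⟧ℤ : ℤ → Carrier
  ⟦ + n ⟧ℤ      = n ×′ 1#
  ⟦ -[1+ n ] ⟧ℤ = - (suc n ×′ 1#)

  ⟦⊖⟧ : ∀ m n → ⟦ m ℤ.⊖ n ⟧ℤ ≈ m ×′ 1# - n ×′ 1#
  ⟦⊖⟧ m       zero    = sym (trans (+-congˡ -0#≈0#) (+-identityʳ _))
  ⟦⊖⟧ zero    (suc n) = sym (+-identityˡ _)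
  ⟦⊖⟧ (suc m) (suc n) rewrite ℤₚ.[1+m]⊖[1+n]≡m⊖n m n = begin
    ⟦ m ℤ.⊖ n ⟧ℤ                           ≈⟨ ⟦⊖⟧ m n ⟩
    m ×′ 1# - n ×′ 1#                      ≈⟨ xyx⁻¹≈y 1# (m ×′ 1# - n ×′ 1#) ⟨
    1# + (m ×′ 1# - n ×′ 1#) - 1#          ≈⟨ +-congʳ (+-assoc 1# _ _) ⟨
    (1# + m ×′ 1#) - n ×′ 1# - 1#          ≈⟨ +-assoc _ _ _ ⟩
    (1# + m ×′ 1#) + (- (n ×′ 1#) + - 1#)  ≈⟨ +-congˡ (-‿+-comm _ _) ⟩
    (1# + m ×′ 1#) - (n ×′ 1# + 1#)        ≈⟨ +-cong (1+× m 1#) (-‿cong (trans (1+× n 1#) (+-comm _ _))) ⟨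
    suc m ×′ 1# - suc n ×′ 1#              ∎

  ⟦-⟧ : ∀ z → ⟦ ℤ.- z ⟧ℤ ≈ - ⟦ z ⟧ℤ
  ⟦-⟧ (+ zero)  = sym -0#≈0#
  ⟦-⟧ (+ suc n) = refl
  ⟦-⟧ -[1+ n ]  = sym (-‿involutive _)

  ⟦+⟧ : ∀ x y → ⟦ x ℤ.+ y ⟧ℤ ≈ ⟦ x ⟧ℤ + ⟦ y ⟧ℤ
  ⟦+⟧ (+ m)    (+ n)    = ×-homo-+ 1# m n
  ⟦+⟧ (+ m)    -[1+ n ] = ⟦⊖⟧ m (suc n)
  ⟦+⟧ -[1+ m ] (+ n)    = trans (⟦⊖⟧ n (suc m)) (+-comm _ _)
  ⟦+⟧ -[1+ m ] -[1+ n ] = begin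
    - (suc (suc (m ℕ.+ n)) ×′ 1#)      ≡⟨ ≡.cong (λ k → - (suc k ×′ 1#)) (ℕₚ.+-suc m n) ⟨
    - ((suc m ℕ.+ suc n) ×′ 1#)        ≈⟨ -‿cong (×-homo-+ 1# (suc m) (suc n)) ⟩
    - (suc m ×′ 1# + suc n ×′ 1#)      ≈⟨ -‿+-comm _ _ ⟨
    - (suc m ×′ 1#) + - (suc n ×′ 1#)  ∎

  ⟦+◃⟧ : ∀ n → ⟦ Sign.+ ℤ.◃ n ⟧ℤ ≈ n ×′ 1#
  ⟦+◃⟧ n rewrite ℤₚ.+◃n≡+n n = refl

  ⟦-◃⟧ : ∀ n → ⟦ Sign.- ℤ.◃ n ⟧ℤ ≈ - (n ×′ 1#)
  ⟦-◃⟧ n rewrite ℤₚ.-◃n≡-n n = ⟦-⟧ (+ n)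

  -x*-y≈x*y : ∀ x y → - x * - y ≈ x * y
  -x*-y≈x*y x y = trans (sym (-‿distribˡ-* x (- y))) (trans (-‿cong (sym (-‿distribʳ-* x y))) (-‿involutive _))

  ⟦*⟧ : ∀ x y → ⟦ x ℤ.* y ⟧ℤ ≈ ⟦ x ⟧ℤ * ⟦ y ⟧ℤ
  ⟦*⟧ (+ m)    (+ n)    = trans (⟦+◃⟧ (m ℕ.* n)) (×1-homo-* m n)
  ⟦*⟧ (+ m)    -[1+ n ] = trans (⟦-◃⟧ (m ℕ.* suc n)) (trans (-‿cong (×1-homo-* m (suc n))) (-‿distribʳ-* _ _))
  ⟦*⟧ -[1+ m ] (+ n)    = trans (⟦-◃⟧ (suc m ℕ.* n)) (trans (-‿cong (×1-homo-* (suc m) n)) (-‿distribˡ-* _ _))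
  ⟦*⟧ -[1+ m ] -[1+ n ] = trans (⟦+◃⟧ (suc m ℕ.* suc n)) (trans (×1-homo-* (suc m) (suc n)) (sym (-x*-y≈x*y _ _)))

  ℤ-morphism : ℤ.+-*-rawRing -Raw-AlmostCommutative⟶ fromCommutativeRing R
  ℤ-morphism = record
    { ⟦_⟧ = ⟦_⟧ℤ ; +-homo = ⟦+⟧ ; *-homo = ⟦*⟧ ; -‿homo = ⟦-⟧ ; 0-homo = refl ; 1-homo = refl }

  ⟦≟⟧ : ∀ x y → Maybe.Maybe (⟦ x ⟧ℤ ≈ ⟦ y ⟧ℤ)
  ⟦≟⟧ x y = Maybe.map (reflexive ∘ ≡.cong ⟦_⟧ℤ) (dec⇒weaklyDec ℤₚ._≟_ x y)

  open import Algebra.Solver.Ring ℤ.+-*-rawRing (fromCommutativeRing R) ℤ-morphism ⟦≟⟧ public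

module CommutativeRingSums {c ℓ : Level} (R : CommutativeRing c ℓ) where
  open CommutativeRing R hiding (zero)
  open import Algebra.Properties.Semiring.Sum semiring public
    using (sum; ∑-distrib-+; ∑-comm; *-distribˡ-sum; *-distribʳ-sum; sum-cong-≋; sum-cong-≗)
  open import Algebra.Properties.Ring ring using (-0#≈0#; -‿+-comm)
  open import Relation.Binary.Reasoning.Setoid setoid
  open IntegerCoefficients R using (solve; _:=_; _:+_; _:*_; _:-_; :-_; con)

  listSum : List Carrier → Carrier
  listSum = foldr _+_ 0#

  listSum-map-tabulate : ∀ {a} {A : Set a} {n} (g : A → Carrier) (f : Fin n → A) →
                         listSum (map g (tabulate f)) ≡ sum (g ∘ f)
  listSum-map-tabulate {n = zero}  g f = ≡.refl
  listSum-map-tabulate {n = suc n} g f = ≡.cong (g (f zero) +_) (listSum-map-tabulate g (f ∘ suc))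

  listSum-map-filter : ∀ {a p} {A : Set a} {P : A → Set p} (P? : Decidable P) (g : A → Carrier) xs →
                       listSum (map g (filter P? xs)) ≈ listSum (map (λ x → if does (P? x) then g x else 0#) xs)
  listSum-map-filter P? g []       = refl
  listSum-map-filter P? g (x ∷ xs) with does (P? x)
  ... | false = trans (listSum-map-filter P? g xs) (sym (+-identityˡ _))
  ... | true  = +-congˡ (listSum-map-filter P? g xs)

  listSum-map-++ : ∀ {a} {A : Set a} (g : A → Carrier) xs ys →
                   listSum (map g (xs ++ ys)) ≈ listSum (map g xs) + listSum (map g ys)
  listSum-map-++ g []       ys = sym (+-identityˡ _)
  listSum-map-++ g (x ∷ xs) ys = trans (+-congˡ (listSum-map-++ g xs ys)) (sym (+-assoc _ _ _))

  listSum-map-cartesianProduct : ∀ {a b} {A : Set a} {B : Set b} (g : A × B → Carrier) xs ys →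
    listSum (map g (cartesianProduct xs ys)) ≈ listSum (map (λ x → listSum (map (λ y → g (x , y)) ys)) xs)
  listSum-map-cartesianProduct g []       ys = refl
  listSum-map-cartesianProduct g (x ∷ xs) ys = begin
    listSum (map g (map (x ,_) ys ++ cartesianProduct xs ys))
      ≈⟨ listSum-map-++ g (map (x ,_) ys) _ ⟩
    listSum (map g (map (x ,_) ys)) + listSum (map g (cartesianProduct xs ys))
      ≡⟨ ≡.cong (λ zs → listSum zs + _) (≡.sym (Listₚ.map-∘ ys)) ⟩
    listSum (map (λ y → g (x , y)) ys) + listSum (map g (cartesianProduct xs ys))
      ≈⟨ +-congˡ (listSum-map-cartesianProduct g xs ys) ⟩
    listSum (map (λ y → g (x , y)) ys) + listSum (map (λ x → listSum (map (λ y → g (x , y)) ys)) xs) ∎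

  ∑-↑ : ∀ m {n} (f : Fin (m ℕ.+ n) → Carrier) → sum f ≈ sum (f ∘ (_↑ˡ n)) + sum (f ∘ (m ↑ʳ_))
  ∑-↑ zero    f = sym (+-identityˡ _)
  ∑-↑ (suc m) f = trans (+-congˡ (∑-↑ m (f ∘ suc))) (sym (+-assoc _ _ _))

  ∑-0 : ∀ n → sum {n} (λ _ → 0#) ≈ 0#
  ∑-0 zero    = refl
  ∑-0 (suc n) = trans (+-identityˡ _) (∑-0 n)

  ∑-neg : ∀ {n} (f : Fin n → Carrier) → sum (λ i → - f i) ≈ - sum f
  ∑-neg {zero}  f = sym -0#≈0#
  ∑-neg {suc n} f = trans (+-congˡ (∑-neg (f ∘ suc))) (-‿+-comm _ _)

  ∑-shifted-product : ∀ {n} (p q : Fin n → Carrier) c w →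
    sum (λ a → (p a - c) * (w - q a)) ≈ sum (λ a → p a - c) * w - sum (λ a → p a * q a) + c * sum q
  ∑-shifted-product p q c w = begin
    sum (λ a → (p a - c) * (w - q a))
      ≈⟨ sum-cong-≋ (λ a → solve 4 (λ p q c w → (p :- c) :* (w :- q) := (p :- c) :* w :+ (:- (p :* q) :+ c :* q))
                                  refl (p a) (q a) c w) ⟩
    sum (λ a → (p a - c) * w + (- (p a * q a) + c * q a))
      ≈⟨ trans (∑-distrib-+ (λ a → (p a - c) * w) _) (+-congˡ (∑-distrib-+ (λ a → - (p a * q a)) (λ a → c * q a))) ⟩
    sum (λ a → (p a - c) * w) + (sum (λ a → - (p a * q a)) + sum (λ a → c * q a))
      ≈⟨ +-cong (sym (*-distribʳ-sum w (λ a → p a - c))) (+-cong (∑-neg (λ a → p a * q a)) (sym (*-distribˡ-sum c q))) ⟩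
    sum (λ a → p a - c) * w + (- sum (λ a → p a * q a) + c * sum q)
      ≈⟨ sym (+-assoc _ _ _) ⟩
    sum (λ a → p a - c) * w - sum (λ a → p a * q a) + c * sum q ∎

  ∑-δ : ∀ {n} (i : Fin n) (f : Fin n → Carrier) → sum (λ j → if does (i Fin.≟ j) then f j else 0#) ≈ f i
  ∑-δ {suc n} zero    f = trans (+-congˡ (∑-0 n)) (+-identityʳ _)
  ∑-δ {suc n} (suc i) f = trans (+-identityˡ _) (∑-δ i (f ∘ suc))

  e₂ : ∀ {n} → (Fin n → Carrier) → Carrier
  e₂ f = sum (λ i → sum (λ j → if does (toℕ i ℕ.<? toℕ j) then f i * f j else 0#))

  private
    *-trichotomy : ∀ {n} (f : Fin n → Carrier) i j → f i * f j ≈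
      (if does (toℕ i ℕ.<? toℕ j) then f i * f j else 0#) +
      (if does (toℕ j ℕ.<? toℕ i) then f j * f i else 0#) +
      (if does (i Fin.≟ j) then f i * f j else 0#)
    *-trichotomy f i j with Finₚ.<-cmp i j
    ... | tri< i<j i≢j j≮i
      rewrite dec-true (toℕ i ℕ.<? toℕ j) i<j | dec-false (toℕ j ℕ.<? toℕ i) j≮i | dec-false (i Fin.≟ j) i≢j
      = solve 1 (λ x → x := x :+ con (ℤ.+ 0) :+ con (ℤ.+ 0)) refl _
    ... | tri≈ i≮j ≡.refl _
      rewrite dec-false (toℕ i ℕ.<? toℕ i) i≮j | dec-true (i Fin.≟ i) ≡.refl
      = solve 1 (λ x → x := con (ℤ.+ 0) :+ con (ℤ.+ 0) :+ x) refl _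
    ... | tri> i≮j i≢j j<i
      rewrite dec-false (toℕ i ℕ.<? toℕ j) i≮j | dec-true (toℕ j ℕ.<? toℕ i) j<i | dec-false (i Fin.≟ j) i≢j
      = solve 2 (λ x y → x :* y := con (ℤ.+ 0) :+ y :* x :+ con (ℤ.+ 0)) refl _ _

  sum²≈e₂+e₂+∑² : ∀ {n} (f : Fin n → Carrier) → sum f * sum f ≈ e₂ f + e₂ f + sum (λ i → f i * f i)
  sum²≈e₂+e₂+∑² {n} f = begin
    sum f * sum f
      ≈⟨ trans (*-distribʳ-sum (sum f) f) (sum-cong-≋ (λ i → *-distribˡ-sum (f i) f)) ⟩
    sum (λ i → sum (λ j → f i * f j))
      ≈⟨ sum-cong-≋ (λ i → trans (sum-cong-≋ (*-trichotomy f i)) (split₃ (lt i) (λ j → lt j i) (eq i))) ⟩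
    sum (λ i → sum (λ j → lt i j) + sum (λ j → lt j i) + sum (λ j → eq i j))
      ≈⟨ split₃ (λ i → sum (lt i)) (λ i → sum (λ j → lt j i)) (λ i → sum (eq i)) ⟩
    e₂ f + sum (λ i → sum (λ j → lt j i)) + sum (λ i → sum (λ j → eq i j))
      ≈⟨ +-cong (+-congˡ (∑-comm (λ i j → lt j i))) (sum-cong-≋ (λ i → ∑-δ i (λ j → f i * f j))) ⟩
    e₂ f + e₂ f + sum (λ i → f i * f i) ∎
    where
    lt eq : Fin n → Fin n → Carrier
    lt i j = if does (toℕ i ℕ.<? toℕ j) then f i * f j else 0#
    eq i j = if does (i Fin.≟ j) then f i * f j else 0#
    split₃ : ∀ {m} (g h k : Fin m → Carrier) → sum (λ i → g i + h i + k i) ≈ sum g + sum h + sum k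
    split₃ g h k = trans (∑-distrib-+ (λ i → g i + h i) k) (+-congʳ (∑-distrib-+ g h))

  listSum-ordered-pairs≈e₂ : ∀ {n} (f : Fin n → Carrier) →
    listSum (map (λ ij → f (proj₁ ij) * f (proj₂ ij))
                 (filter (λ ij → toℕ (proj₁ ij) ℕ.<? toℕ (proj₂ ij)) (cartesianProduct (allFin n) (allFin n))))
    ≈ e₂ f
  listSum-ordered-pairs≈e₂ {n} f = begin
    listSum (map (λ ij → f (proj₁ ij) * f (proj₂ ij)) (filter _ (cartesianProduct (allFin n) (allFin n))))
      ≈⟨ listSum-map-filter _ _ (cartesianProduct (allFin n) (allFin n)) ⟩
    listSum (map (λ ij → term (proj₁ ij) (proj₂ ij)) (cartesianProduct (allFin n) (allFin n)))
      ≈⟨ listSum-map-cartesianProduct _ (allFin n) (allFin n) ⟩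
    listSum (map (λ i → listSum (map (term i) (allFin n))) (allFin n))
      ≡⟨ listSum-map-tabulate (λ i → listSum (map (term i) (allFin n))) (λ i → i) ⟩
    sum (λ i → listSum (map (term i) (allFin n)))
      ≡⟨ sum-cong-≗ (λ i → listSum-map-tabulate (term i) (λ j → j)) ⟩
    e₂ f ∎
    where
    term : Fin n → Fin n → Carrier
    term i j = if does (toℕ i ℕ.<? toℕ j) then f i * f j else 0#

module GaussianIdentities {c ℓ : Level} (R : CommutativeRing c ℓ) where
  open CommutativeRing R
  open IntegerCoefficients R using (solve; _:=_; _:+_; _:*_; _:-_; :-_; con)

  +-vanishingʳ : ∀ {a} x y → a ≈ 0# → x + a * y ≈ x
  +-vanishingʳ x y a≈0 = trans (+-congˡ (trans (*-congʳ a≈0) (zeroˡ y))) (+-identityʳ x)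

  module _ (ι : Carrier) (ι²≈-1 : ι * ι ≈ - 1#) where

    ι²+1≈0 : ι * ι + 1# ≈ 0#
    ι²+1≈0 = trans (+-congʳ ι²≈-1) (-‿inverseˡ 1#)

    conjugate-product : ∀ u v → (u + ι * v) * (u - ι * v) ≈ u * u + v * v
    conjugate-product u v = trans
      (solve 3 (λ u v ι → (u :+ ι :* v) :* (u :- ι :* v) := u :* u :+ v :* v :+ (ι :* ι :+ con (ℤ.+ 1)) :* (:- (v :* v)))
             refl u v ι)
      (+-vanishingʳ _ _ ι²+1≈0)

    square-in-conjugates : ∀ U V →
      ι * ((U - ι * V) * (U - ι * V) - (U + ι * V) * (U + ι * V)) +
      ((U + ι * V) * (U - ι * V) + (U + ι * V) * (U - ι * V))
      ≈ (U + V) * (U + V) + (U + V) * (U + V)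
    square-in-conjugates U V = trans
      (solve 3 (λ U V ι →
          ι :* ((U :- ι :* V) :* (U :- ι :* V) :- (U :+ ι :* V) :* (U :+ ι :* V)) :+
          ((U :+ ι :* V) :* (U :- ι :* V) :+ (U :+ ι :* V) :* (U :- ι :* V))
        := (U :+ V) :* (U :+ V) :+ (U :+ V) :* (U :+ V)
           :+ (ι :* ι :+ con (ℤ.+ 1)) :* (:- (con (ℤ.+ 4) :* U :* V :+ con (ℤ.+ 2) :* V :* V))) refl U V ι)
      (+-vanishingʳ _ _ ι²+1≈0)

    module _ (t M : Carrier) (t²≈2M+1 : t * t ≈ M + (1# + M)) where

      t²-2M-1≈0 : t * t - (M + (1# + M)) ≈ 0#
      t²-2M-1≈0 = trans (+-congʳ t²≈2M+1) (-‿inverseʳ _)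

      binary-form-factorisation : ∀ Y Z y S →
        ι * ((Z - (ι * (M * y) + t * y)) * (Z - (ι * (M * y) - t * y))) +
        ((Y - (1# + M) * y) * ((Z + Z) - ι * (Y + (1# + M) * y)) - S + y * (Z + Z))
        ≈ ι * (Z * Z - Y * Y) + (Y * Z + Y * Z) - S
      binary-form-factorisation Y Z y S = trans
        (solve 7 (λ Y Z y S ι t M →
            ι :* ((Z :- (ι :* (M :* y) :+ t :* y)) :* (Z :- (ι :* (M :* y) :- t :* y))) :+
            ((Y :- (con (ℤ.+ 1) :+ M) :* y) :* ((Z :+ Z) :- ι :* (Y :+ (con (ℤ.+ 1) :+ M) :* y)) :- S :+ y :* (Z :+ Z))
          := ι :* (Z :* Z :- Y :* Y) :+ (Y :* Z :+ Y :* Z) :- S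
             :+ (ι :* ι :+ con (ℤ.+ 1)) :* (ι :* M :* M :* y :* y :- con (ℤ.+ 2) :* M :* y :* Z)
             :+ (t :* t :- (M :+ (con (ℤ.+ 1) :+ M))) :* (:- (ι :* y :* y))) refl Y Z y S ι t M)
        (trans (+-vanishingʳ _ _ t²-2M-1≈0) (+-vanishingʳ _ _ ι²+1≈0))

module PolynomialRing {c ℓ : Level} (F : Field c ℓ) (n : ℕ) where
  open Field F using (Carrier; _+_; _*_; -_; 0#; 1#)
  open FieldDefs F

  ≃-setoid : Setoid c (c ⊔ ℓ)
  ≃-setoid = record
    { Carrier = Poly n ; _≈_ = _≃_ ; isEquivalence = record { refl = ≃-refl ; sym = ≃-sym ; trans = ≃-trans } }

  polyRing : CommutativeRing c (c ⊔ ℓ)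
  polyRing = record
    { Carrier = Poly n ; _≈_ = _≃_ ; _+_ = _⊕_ ; _*_ = _⊗_ ; -_ = ⊖_ ; 0# = con 0# ; 1# = con 1#
    ; isCommutativeRing = record
      { isRing = record
        { +-isAbelianGroup = record
          { isGroup = record
            { isMonoid = record
              { isSemigroup = record
                { isMagma = record { isEquivalence = Setoid.isEquivalence ≃-setoid ; ∙-cong = ⊕-cong }
                ; assoc = ⊕-assoc }
              ; identity = comm∧idˡ⇒id ⊕-comm ⊕-idˡ }
            ; inverse = comm∧invˡ⇒inv ⊕-comm ⊖-invˡ
            ; ⁻¹-cong = ⊖-cong }
          ; comm = ⊕-comm }
        ; *-cong = ⊗-cong
        ; *-assoc = ⊗-assoc
        ; *-identity = comm∧idˡ⇒id ⊗-comm ⊗-idˡ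
        ; distrib = comm∧distrˡ⇒distr ⊕-cong ⊗-comm ⊗-distribˡ }
      ; *-comm = ⊗-comm } }
    where open import Algebra.Consequences.Setoid ≃-setoid using (comm∧idˡ⇒id; comm∧invˡ⇒inv; comm∧distrˡ⇒distr)

  open CommutativeRing polyRing public using () renaming
    (+-congˡ to ⊕-congˡ; +-congʳ to ⊕-congʳ; *-congˡ to ⊗-congˡ; *-congʳ to ⊗-congʳ)

  private
    module P = CommutativeRing polyRing
    module P∑ = CommutativeRingSums polyRing
    module F∑ = CommutativeRingSums (Field.commutativeRing F)
    open import Algebra.Properties.Ring P.ring using (-‿distribˡ-*)

  con-neg : ∀ a → con (- a) ≃ ⊖ con a
  con-neg a = inverseʳ-unique (con a) (con (- a))
    (≃-trans (≃-sym (con-+ a (- a))) (con-cong (Field.-‿inverseʳ F a)))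
    where open import Algebra.Properties.Group P.+-group using (inverseʳ-unique)

  con-sum : ∀ {m} (f : Fin m → Carrier) → con (F∑.sum f) ≃ P∑.sum (con ∘ f)
  con-sum {zero}  f = ≃-refl
  con-sum {suc m} f = ≃-trans (con-+ _ _) (⊕-congˡ (con-sum (f ∘ suc)))

  sum-replicate≃fromℕ : ∀ m x → P∑.sum {m} (λ _ → x) ≃ con (fromℕ m) ⊗ x
  sum-replicate≃fromℕ zero    x = ≃-sym (P.zeroˡ x)
  sum-replicate≃fromℕ (suc m) x = ≃-trans (⊕-cong (≃-sym (⊗-idˡ x)) (sum-replicate≃fromℕ m x))
                                  (≃-trans (≃-sym (P.distribʳ x _ _)) (⊗-congʳ (≃-sym (con-+ _ _))))

  -- Linear forms are written as expressions, from which both their coefficient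
  -- vectors and their values in Poly n are computed.
  infixl 6 _‵+_
  infixr 7 _‵*_
  infix  8 ‵-_

  data LinExpr : Set c where
    ‵X   : Fin n → LinExpr
    _‵+_ : LinExpr → LinExpr → LinExpr
    _‵*_ : Carrier → LinExpr → LinExpr
    ‵-_  : LinExpr → LinExpr
    ‵∑   : ∀ {m} → (Fin m → LinExpr) → LinExpr

  ⟦_⟧ : LinExpr → Poly n
  ⟦ ‵X j    ⟧ = var j
  ⟦ e ‵+ e′ ⟧ = ⟦ e ⟧ ⊕ ⟦ e′ ⟧
  ⟦ a ‵* e  ⟧ = con a ⊗ ⟦ e ⟧
  ⟦ ‵- e    ⟧ = ⊖ ⟦ e ⟧
  ⟦ ‵∑ es   ⟧ = P∑.sum (λ i → ⟦ es i ⟧)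

  coefficients : LinExpr → Fin n → Carrier
  coefficients (‵X j)    j′ = if does (j Fin.≟ j′) then 1# else 0#
  coefficients (e ‵+ e′) j  = coefficients e j + coefficients e′ j
  coefficients (a ‵* e)  j  = a * coefficients e j
  coefficients (‵- e)    j  = - coefficients e j
  coefficients (‵∑ es)   j  = F∑.sum (λ i → coefficients (es i) j)

  linear : (Fin n → Carrier) → Poly n
  linear a = P∑.sum (λ j → con (a j) ⊗ var j)

  linear-unit : ∀ j → linear (λ j′ → if does (j Fin.≟ j′) then 1# else 0#) ≃ var j
  linear-unit j = ≃-trans (P∑.sum-cong-≋ unit) (P∑.∑-δ j var)
    where
    unit : ∀ j′ → con (if does (j Fin.≟ j′) then 1# else 0#) ⊗ var j′ ≃ (if does (j Fin.≟ j′) then var j′ else con 0#)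
    unit j′ with does (j Fin.≟ j′)
    ... | true  = ⊗-idˡ (var j′)
    ... | false = P.zeroˡ (var j′)

  linear-+ : ∀ a b → linear (λ j → a j + b j) ≃ linear a ⊕ linear b
  linear-+ a b = ≃-trans (P∑.sum-cong-≋ (λ j → ≃-trans (⊗-congʳ (con-+ (a j) (b j))) (P.distribʳ (var j) _ _)))
                         (P∑.∑-distrib-+ (λ j → con (a j) ⊗ var j) (λ j → con (b j) ⊗ var j))

  linear-* : ∀ x a → linear (λ j → x * a j) ≃ con x ⊗ linear a
  linear-* x a = ≃-trans (P∑.sum-cong-≋ (λ j → ≃-trans (⊗-congʳ (con-* x (a j))) (⊗-assoc _ _ _)))
                         (≃-sym (P∑.*-distribˡ-sum (con x) (λ j → con (a j) ⊗ var j)))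

  linear-neg : ∀ a → linear (λ j → - a j) ≃ ⊖ linear a
  linear-neg a = ≃-trans (P∑.sum-cong-≋ (λ j → ≃-trans (⊗-congʳ (con-neg (a j))) (≃-sym (-‿distribˡ-* _ _))))
                         (P∑.∑-neg (λ j → con (a j) ⊗ var j))

  linear-∑ : ∀ {m} (as : Fin m → Fin n → Carrier) →
             linear (λ j → F∑.sum (λ i → as i j)) ≃ P∑.sum (λ i → linear (as i))
  linear-∑ as = ≃-trans (P∑.sum-cong-≋ (λ j → ≃-trans (⊗-congʳ (con-sum (λ i → as i j)))
                                                       (P∑.*-distribʳ-sum (var j) (λ i → con (as i j)))))
                        (P∑.∑-comm (λ j i → con (as i j) ⊗ var j))

  linear-coefficients : ∀ e → linear (coefficients e) ≃ ⟦ e ⟧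
  linear-coefficients (‵X j)    = linear-unit j
  linear-coefficients (e ‵+ e′) = ≃-trans (linear-+ (coefficients e) (coefficients e′))
                                          (⊕-cong (linear-coefficients e) (linear-coefficients e′))
  linear-coefficients (a ‵* e)  = ≃-trans (linear-* a (coefficients e)) (⊗-congˡ (linear-coefficients e))
  linear-coefficients (‵- e)    = ≃-trans (linear-neg (coefficients e)) (⊖-cong (linear-coefficients e))
  linear-coefficients (‵∑ es)   = ≃-trans (linear-∑ (coefficients ∘ es))
                                          (P∑.sum-cong-≋ (λ i → linear-coefficients (es i)))

  linearForm : LinExpr → LinearForm n
  linearForm e = 0# , coefficients e

  ⟦linearForm⟧ : ∀ e → ⟦ linearForm e ⟧L ≃ ⟦ e ⟧
  ⟦linearForm⟧ e = ≃-trans (⊕-idˡ _)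
    (≃-trans (P.reflexive (P∑.listSum-map-tabulate (λ j → con (coefficients e j) ⊗ var j) (λ j → j)))
             (linear-coefficients e))

  productCircuit : ∀ {k} → (Fin k → LinExpr) → (Fin k → LinExpr) → Circuit n
  productCircuit L M = tabulate (λ i → linearForm (L i) ∷ linearForm (M i) ∷ [])

  productCircuit-homogeneous : ∀ {k} (L M : Fin k → LinExpr) → Homogeneous (productCircuit L M)
  productCircuit-homogeneous L M = tabulate⁺ (λ i → Field.refl F ∷ Field.refl F ∷ [])

  productCircuit-gates : ∀ {k} (L M : Fin k → LinExpr) → gates (productCircuit L M) ≡ k
  productCircuit-gates L M = Listₚ.length-tabulate _

  ⟦productCircuit⟧ : ∀ {k} (L M : Fin k → LinExpr) →
                     ⟦ productCircuit L M ⟧C ≃ P∑.sum (λ i → ⟦ L i ⟧ ⊗ ⟦ M i ⟧)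
  ⟦productCircuit⟧ L M = ≃-trans
    (P.reflexive (P∑.listSum-map-tabulate (λ g → prodP (map ⟦_⟧L g)) (λ i → linearForm (L i) ∷ linearForm (M i) ∷ [])))
    (P∑.sum-cong-≋ (λ i → ⊗-cong (⟦linearForm⟧ (L i)) (≃-trans (P.*-identityʳ _) (⟦linearForm⟧ (M i)))))

  S2≃e₂ : S2 n ≃ P∑.e₂ var
  S2≃e₂ = P∑.listSum-ordered-pairs≈e₂ var

module _ {c ℓ : Level} (F : Field c ℓ) where
  open Field F hiding (zero)
  open FieldDefs F

  fromℕ-+ : ∀ a b → fromℕ (a ℕ.+ b) ≈ fromℕ a + fromℕ b
  fromℕ-+ zero    b = sym (+-identityˡ _)
  fromℕ-+ (suc a) b = trans (+-congˡ (fromℕ-+ a b)) (sym (+-assoc _ _ _))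

  module Construction (m : ℕ) (ι t h : Carrier) (ι²≈-1 : ι * ι ≈ - 1#)
                      (t²≈2m+1 : t * t ≈ fromℕ (2 ℕ.* suc m ℕ.∸ 1)) (2h≈1 : (1# + 1#) * h ≈ 1#) where

    k N : ℕ
    k = suc m
    N = 2 ℕ.* k

    open PolynomialRing F N
    module R = CommutativeRing polyRing
    open CommutativeRingSums polyRing
    open GaussianIdentities polyRing
    open IntegerCoefficients polyRing using (solve; _:=_; _:+_; _:*_; _:-_; con)
    open import Relation.Binary.Reasoning.Setoid ≃-setoid

    ι̂ t̂ ĥ M̂ K̂ : Poly N
    ι̂ = con ι
    t̂ = con t
    ĥ = con h
    M̂ = con (fromℕ m)
    K̂ = con 1# ⊕ M̂

    ι̂²≈-1 : ι̂ ⊗ ι̂ ≃ ⊖ con 1#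
    ι̂²≈-1 = ≃-trans (≃-sym (con-* ι ι)) (≃-trans (con-cong ι²≈-1) (con-neg 1#))

    t̂²≈2M̂+1 : t̂ ⊗ t̂ ≃ M̂ ⊕ K̂
    t̂²≈2M̂+1 = ≃-trans (≃-sym (con-* t t)) (≃-trans (con-cong (trans t²≈2m+1 fromℕ-2m+1))
                   (≃-trans (con-+ _ _) (⊕-congˡ (con-+ _ _))))
      where
      fromℕ-2m+1 : fromℕ (m ℕ.+ suc (m ℕ.+ 0)) ≈ fromℕ m + (1# + fromℕ m)
      fromℕ-2m+1 rewrite ℕₚ.+-identityʳ m = fromℕ-+ m (suc m)

    ĥ+ĥ≈1 : ĥ ⊕ ĥ ≃ con 1#
    ĥ+ĥ≈1 = ≃-trans (≃-sym (con-+ h h)) (con-cong (trans h+h≈2h 2h≈1))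
      where
      h+h≈2h : h + h ≈ (1# + 1#) * h
      h+h≈2h = sym (trans (distribʳ h 1# 1#) (+-cong (*-identityˡ h) (*-identityˡ h)))

    -- N reduces to k + (k + 0).
    left right : Fin k → Fin N
    left  a = a ↑ˡ (k ℕ.+ 0)
    right a = k ↑ʳ (a ↑ˡ 0)

    ∑-halves : ∀ f → sum f ≃ sum (f ∘ left) ⊕ sum (f ∘ right)
    ∑-halves f = ≃-trans (∑-↑ k f) (⊕-congˡ (≃-trans (∑-↑ k (f ∘ (k ↑ʳ_))) (R.+-identityʳ _)))

    u v y z : Fin k → LinExpr
    u a = ‵X (left a)
    v a = ‵X (right a)
    y a = u a ‵+ ι ‵* v a
    z a = u a ‵+ ‵- (ι ‵* v a)

    Y Z Z-r₊y₀ Z-r₋y₀ : LinExpr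
    Y = ‵∑ y
    Z = ‵∑ z
    Z-r₊y₀ = Z ‵+ ‵- (ι ‵* fromℕ m ‵* y zero ‵+ t ‵* y zero)
    Z-r₋y₀ = Z ‵+ ‵- (ι ‵* fromℕ m ‵* y zero ‵+ ‵- (t ‵* y zero))

    L Q : Fin k → LinExpr
    L zero    = h ‵* h ‵* ι ‵* Z-r₊y₀
    L (suc b) = h ‵* h ‵* (y (suc b) ‵+ ‵- y zero)
    Q zero    = Z-r₋y₀
    Q (suc b) = (Z ‵+ Z) ‵+ ‵- (ι ‵* ‵∑ (λ a → y a ‵+ y zero)) ‵+ ‵- (z (suc b) ‵+ z (suc b))

    Û V̂ Ŷ Ẑ Sq ŷ₀ : Poly N
    Û  = sum (⟦_⟧ ∘ u)
    Ŷ  = ⟦ Y ⟧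
    Ẑ  = ⟦ Z ⟧
    V̂  = sum (⟦_⟧ ∘ v)
    Sq = sum (λ j → var j ⊗ var j)
    ŷ₀ = ⟦ y zero ⟧

    D W : Fin k → Poly N
    D a = ⟦ y a ⟧ ⊕ ⊖ ŷ₀
    W a = (Ẑ ⊕ Ẑ) ⊕ ⊖ (ι̂ ⊗ sum (λ b → ⟦ y b ⟧ ⊕ ŷ₀)) ⊕ ⊖ (⟦ z a ⟧ ⊕ ⟦ z a ⟧)

    ∑-const : ∀ x → sum {k} (λ _ → x) ≃ K̂ ⊗ x
    ∑-const x = ≃-trans (sum-replicate≃fromℕ k x) (⊗-congʳ (con-+ 1# (fromℕ m)))

    Y≈U+ι̂V : Ŷ ≃ Û ⊕ ι̂ ⊗ V̂
    Y≈U+ι̂V = ≃-trans (∑-distrib-+ (⟦_⟧ ∘ u) (λ a → ι̂ ⊗ ⟦ v a ⟧)) (⊕-congˡ (R.sym (*-distribˡ-sum ι̂ (⟦_⟧ ∘ v))))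

    Z≈U-ι̂V : Ẑ ≃ Û ⊕ ⊖ (ι̂ ⊗ V̂)
    Z≈U-ι̂V = ≃-trans (∑-distrib-+ (⟦_⟧ ∘ u) (λ a → ⊖ (ι̂ ⊗ ⟦ v a ⟧)))
               (⊕-congˡ (≃-trans (∑-neg (λ a → ι̂ ⊗ ⟦ v a ⟧)) (⊖-cong (R.sym (*-distribˡ-sum ι̂ (⟦_⟧ ∘ v))))))

    ∑y[z+z]≈Sq+Sq : sum (λ a → ⟦ y a ⟧ ⊗ (⟦ z a ⟧ ⊕ ⟦ z a ⟧)) ≃ Sq ⊕ Sq
    ∑y[z+z]≈Sq+Sq = begin
      sum (λ a → ⟦ y a ⟧ ⊗ (⟦ z a ⟧ ⊕ ⟦ z a ⟧))
        ≈⟨ sum-cong-≋ (λ a → ≃-trans (R.distribˡ _ _ _) (⊕-cong (yz a) (yz a))) ⟩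
      sum (λ a → sq a ⊕ sq a)
        ≈⟨ ∑-distrib-+ sq sq ⟩
      sum sq ⊕ sum sq
        ≈⟨ ⊕-cong Sq-halves Sq-halves ⟩
      Sq ⊕ Sq ∎
      where
      sq : Fin k → Poly N
      sq a = ⟦ u a ⟧ ⊗ ⟦ u a ⟧ ⊕ ⟦ v a ⟧ ⊗ ⟦ v a ⟧
      yz : ∀ a → ⟦ y a ⟧ ⊗ ⟦ z a ⟧ ≃ sq a
      yz a = conjugate-product ι̂ ι̂²≈-1 ⟦ u a ⟧ ⟦ v a ⟧
      Sq-halves : sum sq ≃ Sq
      Sq-halves = ≃-trans (∑-distrib-+ (λ a → ⟦ u a ⟧ ⊗ ⟦ u a ⟧) (λ a → ⟦ v a ⟧ ⊗ ⟦ v a ⟧))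
                          (R.sym (∑-halves (λ j → var j ⊗ var j)))

    ∑DW : sum (λ a → D a ⊗ W a) ≃
          (Ŷ ⊕ ⊖ (K̂ ⊗ ŷ₀)) ⊗ ((Ẑ ⊕ Ẑ) ⊕ ⊖ (ι̂ ⊗ (Ŷ ⊕ K̂ ⊗ ŷ₀))) ⊕ ⊖ (Sq ⊕ Sq) ⊕ ŷ₀ ⊗ (Ẑ ⊕ Ẑ)
    ∑DW = ≃-trans (∑-shifted-product (⟦_⟧ ∘ y) (λ a → ⟦ z a ⟧ ⊕ ⟦ z a ⟧) ŷ₀ _)
      (⊕-cong (⊕-cong (⊗-cong ∑[y-ŷ₀] (⊕-congˡ (⊖-cong (⊗-congˡ ∑[y+ŷ₀])))) (⊖-cong ∑y[z+z]≈Sq+Sq))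
              (⊗-congˡ (∑-distrib-+ (⟦_⟧ ∘ z) (⟦_⟧ ∘ z))))
      where
      ∑[y+ŷ₀] : sum (λ a → ⟦ y a ⟧ ⊕ ŷ₀) ≃ Ŷ ⊕ K̂ ⊗ ŷ₀
      ∑[y+ŷ₀] = ≃-trans (∑-distrib-+ (⟦_⟧ ∘ y) (λ _ → ŷ₀)) (⊕-congˡ (∑-const ŷ₀))
      ∑[y-ŷ₀] : sum D ≃ Ŷ ⊕ ⊖ (K̂ ⊗ ŷ₀)
      ∑[y-ŷ₀] = ≃-trans (∑-distrib-+ (⟦_⟧ ∘ y) (λ _ → ⊖ ŷ₀))
                        (⊕-congˡ (≃-trans (∑-neg {k} (λ _ → ŷ₀)) (⊖-cong (∑-const ŷ₀))))

    -- Four times the value of the circuit: every L carries the factor h² = 1/4.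
    -- The extra summand D zero ⊗ W zero vanishes.
    Γ : Poly N
    Γ = ι̂ ⊗ (⟦ Z-r₊y₀ ⟧ ⊗ ⟦ Z-r₋y₀ ⟧) ⊕ sum (λ a → D a ⊗ W a)

    Γ≈4S2 : Γ ≃ S2 N ⊕ S2 N ⊕ (S2 N ⊕ S2 N)
    Γ≈4S2 = begin
      Γ ≈⟨ ⊕-congˡ ∑DW ⟩
      ι̂ ⊗ (⟦ Z-r₊y₀ ⟧ ⊗ ⟦ Z-r₋y₀ ⟧) ⊕
        ((Ŷ ⊕ ⊖ (K̂ ⊗ ŷ₀)) ⊗ ((Ẑ ⊕ Ẑ) ⊕ ⊖ (ι̂ ⊗ (Ŷ ⊕ K̂ ⊗ ŷ₀))) ⊕ ⊖ (Sq ⊕ Sq) ⊕ ŷ₀ ⊗ (Ẑ ⊕ Ẑ))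
        ≈⟨ binary-form-factorisation ι̂ ι̂²≈-1 t̂ M̂ t̂²≈2M̂+1 Ŷ Ẑ ŷ₀ (Sq ⊕ Sq) ⟩
      ι̂ ⊗ (Ẑ ⊗ Ẑ ⊕ ⊖ (Ŷ ⊗ Ŷ)) ⊕ (Ŷ ⊗ Ẑ ⊕ Ŷ ⊗ Ẑ) ⊕ ⊖ (Sq ⊕ Sq)
        ≈⟨ ⊕-congʳ (⊕-cong (⊗-congˡ (⊕-cong (⊗-cong Z≈U-ι̂V Z≈U-ι̂V) (⊖-cong (⊗-cong Y≈U+ι̂V Y≈U+ι̂V))))
                           (⊕-cong (⊗-cong Y≈U+ι̂V Z≈U-ι̂V) (⊗-cong Y≈U+ι̂V Z≈U-ι̂V))) ⟩
      ι̂ ⊗ ((Û ⊕ ⊖ (ι̂ ⊗ V̂)) ⊗ (Û ⊕ ⊖ (ι̂ ⊗ V̂)) ⊕ ⊖ ((Û ⊕ ι̂ ⊗ V̂) ⊗ (Û ⊕ ι̂ ⊗ V̂))) ⊕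
        ((Û ⊕ ι̂ ⊗ V̂) ⊗ (Û ⊕ ⊖ (ι̂ ⊗ V̂)) ⊕ (Û ⊕ ι̂ ⊗ V̂) ⊗ (Û ⊕ ⊖ (ι̂ ⊗ V̂))) ⊕ ⊖ (Sq ⊕ Sq)
        ≈⟨ ⊕-congʳ (square-in-conjugates ι̂ ι̂²≈-1 Û V̂) ⟩
      (Û ⊕ V̂) ⊗ (Û ⊕ V̂) ⊕ (Û ⊕ V̂) ⊗ (Û ⊕ V̂) ⊕ ⊖ (Sq ⊕ Sq)
        ≈⟨ ⊕-congʳ (⊕-cong [U+V]² [U+V]²) ⟩
      (e₂ var ⊕ e₂ var ⊕ Sq) ⊕ (e₂ var ⊕ e₂ var ⊕ Sq) ⊕ ⊖ (Sq ⊕ Sq)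
        ≈⟨ solve 2 (λ e q → (e :+ e :+ q) :+ (e :+ e :+ q) :- (q :+ q) := e :+ e :+ (e :+ e)) R.refl (e₂ var) Sq ⟩
      e₂ var ⊕ e₂ var ⊕ (e₂ var ⊕ e₂ var)
        ≈⟨ R.sym (⊕-cong (⊕-cong S2≃e₂ S2≃e₂) (⊕-cong S2≃e₂ S2≃e₂)) ⟩
      S2 N ⊕ S2 N ⊕ (S2 N ⊕ S2 N) ∎
      where
      [U+V]² : (Û ⊕ V̂) ⊗ (Û ⊕ V̂) ≃ e₂ var ⊕ e₂ var ⊕ Sq
      [U+V]² = ≃-trans (⊗-cong (R.sym (∑-halves var)) (R.sym (∑-halves var))) (sum²≈e₂+e₂+∑² var)

    circuit≈ĥĥΓ : ⟦ productCircuit L Q ⟧C ≃ ĥ ⊗ (ĥ ⊗ Γ)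
    circuit≈ĥĥΓ = begin
      ⟦ productCircuit L Q ⟧C
        ≈⟨ ⟦productCircuit⟧ L Q ⟩
      (ĥ ⊗ (ĥ ⊗ (ι̂ ⊗ A₊))) ⊗ A₋ ⊕ sum (λ b → (ĥ ⊗ (ĥ ⊗ D (suc b))) ⊗ W (suc b))
        ≈⟨ ⊕-cong (solve 4 (λ h ι a b → (h :* (h :* (ι :* a))) :* b := h :* (h :* (ι :* (a :* b)))) R.refl ĥ ι̂ A₊ A₋)
                  (∑-ĥĥ (D ∘ suc) (W ∘ suc)) ⟩
      ĥ ⊗ (ĥ ⊗ (ι̂ ⊗ (A₊ ⊗ A₋))) ⊕ ĥ ⊗ (ĥ ⊗ sum (λ b → D (suc b) ⊗ W (suc b)))
        ≈⟨ solve 3 (λ h x r → h :* (h :* x) :+ h :* (h :* r) := h :* (h :* (x :+ (con (ℤ.+ 0) :+ r)))) R.refl ĥ _ _ ⟩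
      ĥ ⊗ (ĥ ⊗ (ι̂ ⊗ (A₊ ⊗ A₋) ⊕ (con 0# ⊕ sum (λ b → D (suc b) ⊗ W (suc b)))))
        ≈⟨ ⊗-congˡ (⊗-congˡ (⊕-congˡ (⊕-congʳ (R.sym D₀W₀≈0)))) ⟩
      ĥ ⊗ (ĥ ⊗ Γ) ∎
      where
      A₊ A₋ : Poly N
      A₊ = ⟦ Z-r₊y₀ ⟧
      A₋ = ⟦ Z-r₋y₀ ⟧
      D₀W₀≈0 : D zero ⊗ W zero ≃ con 0#
      D₀W₀≈0 = ≃-trans (⊗-congʳ (R.-‿inverseʳ ŷ₀)) (R.zeroˡ _)
      ∑-ĥĥ : (d e : Fin m → Poly N) → sum (λ b → (ĥ ⊗ (ĥ ⊗ d b)) ⊗ e b) ≃ ĥ ⊗ (ĥ ⊗ sum (λ b → d b ⊗ e b))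
      ∑-ĥĥ d e = ≃-trans (sum-cong-≋ {m} (λ b → ≃-trans (⊗-assoc _ _ _) (⊗-congˡ (⊗-assoc _ _ _))))
        (≃-trans (R.sym (*-distribˡ-sum ĥ (λ b → ĥ ⊗ (d b ⊗ e b)))) (⊗-congˡ (R.sym (*-distribˡ-sum ĥ (λ b → d b ⊗ e b)))))

    ĥĥ[4x]≈x : ∀ x → ĥ ⊗ (ĥ ⊗ (x ⊕ x ⊕ (x ⊕ x))) ≃ x
    ĥĥ[4x]≈x x = ≃-trans (solve 2 (λ h x → h :* (h :* (x :+ x :+ (x :+ x))) := (h :+ h) :* (h :+ h) :* x) R.refl ĥ x)
                   (≃-trans (⊗-congʳ (⊗-cong ĥ+ĥ≈1 ĥ+ĥ≈1)) (≃-trans (⊗-congʳ (⊗-idˡ _)) (⊗-idˡ x)))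

    S2-circuit : ∃ λ (C : Circuit N) → Homogeneous C × gates C ≡ k × ⟦ C ⟧C ≃ S2 N
    S2-circuit = productCircuit L Q , productCircuit-homogeneous L Q , productCircuit-gates L Q ,
                 ≃-trans circuit≈ĥĥΓ (≃-trans (⊗-congˡ (⊗-congˡ Γ≈4S2)) (ĥĥ[4x]≈x (S2 N)))

open import Data.Nat using (_*_; _∸_; _≤_; s≤s; z≤n)

mainTheorem16 : ∀ {c ℓ} (F : Field c ℓ) (k : ℕ) → 1 ≤ k →
    let open FieldDefs F in
    CharNot2 → HasSqrt minusOne → HasSqrt two → HasSqrt (fromℕ (2 * k ∸ 1)) →
    ∃ λ (C : Circuit (2 * k)) → Homogeneous C × gates C ≡ k × ⟦ C ⟧C ≃ S2 (2 * k)
mainTheorem16 F (suc m) (s≤s z≤n) 2≉0 (ι , ι²≈-1) _ (t , t²≈2m+1) with Field.inverse F _ 2≉0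
... | h , 2h≈1 = Construction.S2-circuit F m ι t h ι²≈-1 t²≈2m+1 2h≈1
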